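{- Let $q=2^m$, where $m>1$ is an odd integer with $m\not\equiv 0\pmod 5$. Then the permutation trinomials $F_1(X)=X^{11}\left(X^{10(q-1)}+X^{4(q-1)}+1\right)$ and $F_2(X)=X^{9}\left(X^{8(q-1)}+X^{6(q-1)}+1\right)$ of $\mathbb{F}_{q^2}$ are not QM equivalent over $\mathbb{F}_{q^2}$.
   Context: Two permutation polynomials $f,g\in\mathbb{F}_{Q}[X]$ of $\mathbb{F}_Q$ are called quasi-multiplicative (QM) equivalent if there exist an integer $1\le d<Q-1$ with $\gcd(d,Q-1)=1$ and elements $\alpha,\beta\in\mathbb{F}_Q^*$ such that $f(X)=\alpha\, g(\beta X^d)$. Here $Q=q^2$. -}

module Defs where

open import Level using (Level; _⊔_)
open import Data.Nat using (ℕ; _≤_; _<_; _∸_)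
import Data.Nat
open import Data.Nat.GCD using (gcd)
open import Data.Fin using (Fin)
open import Data.Product using (∃; _×_)
open import Relation.Nullary using (¬_)
open import Relation.Binary.PropositionalEquality as ≡ using (_≡_)
open import Function.Bundles using (Inverse)
open import Algebra.Bundles using (CommutativeRing; Semiring)
import Algebra.Definitions.RawSemiring as RawSemiringDefs

private
  variable
    c ℓ : Level

record IsFiniteFieldOfOrder (R : CommutativeRing c ℓ) (Q : ℕ) : Set (c ⊔ ℓ) where
  open CommutativeRing R
  field
    0≉1     : ¬ (0# ≈ 1#)
    inverse : ∀ x → ¬ (x ≈ 0#) → ∃ λ y → (x * y) ≈ 1#
    card    : Inverse (≡.setoid (Fin Q)) setoid

module _ (R : CommutativeRing c ℓ) where
  open CommutativeRing R
  open RawSemiringDefs (Semiring.rawSemiring semiring) using (_^_)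

  F₁ : ℕ → Carrier → Carrier
  F₁ q x = (x ^ 11) * (((x ^ (10 Data.Nat.* (q ∸ 1))) + (x ^ (4 Data.Nat.* (q ∸ 1)))) + 1#)

  F₂ : ℕ → Carrier → Carrier
  F₂ q x = (x ^ 9) * (((x ^ (8 Data.Nat.* (q ∸ 1))) + (x ^ (6 Data.Nat.* (q ∸ 1)))) + 1#)

  QMEquivalent : ℕ → (Carrier → Carrier) → (Carrier → Carrier) → Set (c ⊔ ℓ)
  QMEquivalent Q f g =
    ∃ λ (d : ℕ) → ∃ λ (α : Carrier) → ∃ λ (β : Carrier) →
      (1 ≤ d) × (d < Q ∸ 1) × (gcd d (Q ∸ 1) ≡ 1) ×
      (¬ (α ≈ 0#)) × (¬ (β ≈ 0#)) ×
      (∀ x → f x ≈ (α * g (β * (x ^ d))))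

-- Multiply the identity F₁(x) = α F₂(β x^d) by x and reduce every exponent modulo
-- n = q² − 1, using x^n = 1 on units (the extra factor x keeps this valid at x = 0).
-- Both sides become polynomials of degree at most n that agree on all q² points, so
-- their coefficients coincide. The three exponents 11 + p(q − 1), p ∈ {10, 4, 0}, of F₁
-- are distinct modulo n, so each equals some exponent d(9 + o(q − 1)), o ∈ {8, 6, 0},
-- of F₂(βX^d) modulo n. Reduced modulo q + 1, which divides n and satisfies q ≡ −1,
-- these read (9 − 2o) d ≡ 11 − 2p; for every choice of the o's a small integer
-- combination eliminates d and leaves a nonzero integer of absolute value at most 32,
-- which q + 1 cannot divide once q ≥ 32. The remaining case q = 8 is settled by
-- checking all d < 63.
module Submission where

open import Defs
open import Algebra.Bundles using (CommutativeRing)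
open import Data.Bool using (if_then_else_)
open import Data.Fin as Fin using (Fin; toℕ; fromℕ<; punchIn; punchOut)
import Data.Fin.Properties as Fin
open import Data.Fin.Permutation as Perm using (Permutation)
open import Data.List using (List; []; _∷_; map; cartesianProduct; upTo)
open import Data.List.Membership.Propositional using (_∈_; _∉_)
open import Data.List.Membership.Propositional.Properties using (∈-map⁺)
open import Data.List.Relation.Unary.All as All using (All; []; _∷_; all?; lookupAny)
open import Data.List.Relation.Unary.All.Properties using (All¬⇒¬Any)
open import Data.List.Relation.Unary.Any as Any using (Any; here; there; any?; satisfied)
open import Data.List.Relation.Unary.Any.Properties using (map⁻)
open import Data.List.Relation.Unary.AllPairs using ([]; _∷_)
open import Data.List.Relation.Unary.Unique.Propositional using (Unique)
import Data.List.Relation.Unary.Unique.Propositional.Properties as Unique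
open import Data.Nat as ℕ using (ℕ; zero; suc; _<_; _≤_; _∸_; _≡ᵇ_; _%_; _/_; NonZero; s≤s; z≤n)
import Data.Nat.Properties as ℕ
open import Data.Nat.DivMod using (m≡m%n+[m/n]*n; m%n<n)
open import Data.List.Membership.DecPropositional ℕ._≟_ using (_∈?_)
open import Data.Product using (_×_; _,_; proj₁; proj₂)
open import Data.Sum using (_⊎_; inj₁; inj₂)
open import Function using (_∘_; Inverse)
open import Relation.Binary using (Decidable)
open import Relation.Binary.PropositionalEquality as ≡ using (_≡_; _≢_)
open import Relation.Nullary using (¬_; ¬?; Dec; yes; no; contradiction)
open import Relation.Nullary.Decidable using (from-yes; _×-dec_; True; toWitness)

-- Polynomials

module Polynomials {c ℓ} (R : CommutativeRing c ℓ) where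
  open CommutativeRing R
  open import Algebra.Properties.Ring ring using (-‿distribˡ-*; -‿+-comm; -0#≈0#; x∙y⁻¹≈ε⇒x≈y)
  open import Algebra.Properties.Semiring.Exp semiring using (_^_; ^-homo-*)
  open import Algebra.Properties.CommutativeSemigroup +-commutativeSemigroup using (interchange)
  open import Algebra.Properties.CommutativeSemigroup *-commutativeSemigroup using (x∙yz≈y∙xz)
  open import Algebra.Solver.Ring.NaturalCoefficients.Default commutativeSemiring using (solve; _:+_; _:*_; _:=_)
  open import Relation.Binary.Reasoning.Setoid setoid

  horner : ℕ → (ℕ → Carrier) → Carrier → Carrier
  horner zero    p x = 0#
  horner (suc L) p x = p 0 + x * horner L (p ∘ suc) x

  horner-zero : ∀ L {p} → (∀ k → p k ≈ 0#) → ∀ x → horner L p x ≈ 0#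
  horner-zero zero    p≈0 x = refl
  horner-zero (suc L) p≈0 x = begin
    _ + x * horner L _ x  ≈⟨ +-cong (p≈0 0) (*-congˡ (horner-zero L (p≈0 ∘ suc) x)) ⟩
    0# + x * 0#           ≈⟨ +-identityˡ _ ⟩
    x * 0#                ≈⟨ zeroʳ x ⟩
    0#                    ∎

  horner-+ : ∀ L p r x → horner L (λ k → p k + r k) x ≈ horner L p x + horner L r x
  horner-+ zero    p r x = sym (+-identityʳ 0#)
  horner-+ (suc L) p r x = begin
    (p 0 + r 0) + x * horner L (λ k → p (suc k) + r (suc k)) x
      ≈⟨ +-congˡ (*-congˡ (horner-+ L (p ∘ suc) (r ∘ suc) x)) ⟩
    (p 0 + r 0) + x * (horner L (p ∘ suc) x + horner L (r ∘ suc) x)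
      ≈⟨ +-congˡ (distribˡ x _ _) ⟩
    (p 0 + r 0) + (x * horner L (p ∘ suc) x + x * horner L (r ∘ suc) x)
      ≈⟨ interchange _ _ _ _ ⟩
    (p 0 + x * horner L (p ∘ suc) x) + (r 0 + x * horner L (r ∘ suc) x) ∎

  horner-neg : ∀ L p x → horner L (λ k → - p k) x ≈ - horner L p x
  horner-neg zero    p x = sym -0#≈0#
  horner-neg (suc L) p x = begin
    - p 0 + x * horner L (λ k → - p (suc k)) x  ≈⟨ +-congˡ (*-congˡ (horner-neg L (p ∘ suc) x)) ⟩
    - p 0 + x * - horner L (p ∘ suc) x          ≈⟨ +-congˡ (*-comm x _) ⟩
    - p 0 + - horner L (p ∘ suc) x * x          ≈⟨ +-congˡ (sym (-‿distribˡ-* _ x)) ⟩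
    - p 0 + - (horner L (p ∘ suc) x * x)        ≈⟨ -‿+-comm _ _ ⟩
    - (p 0 + horner L (p ∘ suc) x * x)          ≈⟨ -‿cong (+-congˡ (*-comm _ x)) ⟩
    - (p 0 + x * horner L (p ∘ suc) x)          ∎

  horner-- : ∀ L p r x → horner L (λ k → p k - r k) x ≈ horner L p x - horner L r x
  horner-- L p r x = trans (horner-+ L p (λ k → - r k) x) (+-congˡ (horner-neg L r x))

  -- Synthetic division of a polynomial with suc L coefficients by X - r.
  quotient : ℕ → (ℕ → Carrier) → Carrier → ℕ → Carrier
  quotient zero    p r j       = 0#
  quotient (suc L) p r zero    = horner (suc L) (p ∘ suc) r
  quotient (suc L) p r (suc j) = quotient L (p ∘ suc) r j

  quotient-zero : ∀ L p r → quotient L p r 0 ≈ horner L (p ∘ suc) r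
  quotient-zero zero    p r = refl
  quotient-zero (suc L) p r = refl

  quotient-beyond : ∀ L p r k → L ≤ k → quotient L p r k ≡ 0#
  quotient-beyond zero    p r k       _         = ≡.refl
  quotient-beyond (suc L) p r (suc k) (s≤s L≤k) = quotient-beyond L (p ∘ suc) r k L≤k

  horner-quotient : ∀ L p r x → horner (suc L) p x ≈ horner (suc L) p r + (x - r) * horner L (quotient L p r) x
  horner-quotient zero p r x = begin
    p 0 + x * 0#                  ≈⟨ +-congˡ (trans (zeroʳ x) (sym (zeroʳ r))) ⟩
    p 0 + r * 0#                  ≈⟨ sym (+-identityʳ _) ⟩
    (p 0 + r * 0#) + 0#           ≈⟨ +-congˡ (sym (zeroʳ (x - r))) ⟩
    (p 0 + r * 0#) + (x - r) * 0# ∎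
  horner-quotient (suc L) p r x = begin
    p 0 + x * horner (suc L) (p ∘ suc) x     ≈⟨ +-congˡ (*-congˡ (horner-quotient L (p ∘ suc) r x)) ⟩
    p 0 + x * (a + (x - r) * b)              ≈⟨ sym (+-identityʳ _) ⟩
    (p 0 + x * (a + (x - r) * b)) + 0#       ≈⟨ +-congˡ (sym (trans (*-congʳ (-‿inverseʳ r)) (zeroˡ a))) ⟩
    (p 0 + x * (a + (x - r) * b)) + (r - r) * a ≈⟨ sym (identity (p 0) x r (- r) a b) ⟩
    (p 0 + r * a) + (x - r) * (a + x * b)    ∎
    where
    a = horner (suc L) (p ∘ suc) r
    b = horner L (quotient L (p ∘ suc) r) x
    identity : ∀ p₀ x r s a b → (p₀ + r * a) + (x + s) * (a + x * b) ≈ (p₀ + x * (a + (x + s) * b)) + (r + s) * a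
    identity = solve 6 (λ p₀ x r s a b →
      ((p₀ :+ r :* a) :+ (x :+ s) :* (a :+ x :* b)) := ((p₀ :+ x :* (a :+ (x :+ s) :* b)) :+ (r :+ s) :* a)) refl

  coefficient-quotient : ∀ L p r j → j < L → p (suc j) ≈ quotient L p r j - r * quotient L p r (suc j)
  coefficient-quotient (suc L) p r zero    _         = sym (begin
    (p 1 + r * h) - r * quotient L (p ∘ suc) r 0 ≈⟨ +-congˡ (-‿cong (*-congˡ (quotient-zero L (p ∘ suc) r))) ⟩
    (p 1 + r * h) - r * h                        ≈⟨ +-assoc _ _ _ ⟩
    p 1 + (r * h - r * h)                        ≈⟨ +-congˡ (-‿inverseʳ _) ⟩
    p 1 + 0#                                     ≈⟨ +-identityʳ _ ⟩
    p 1                                          ∎)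
    where h = horner L (p ∘ suc ∘ suc) r
  coefficient-quotient (suc L) p r (suc j) (s≤s j<L) = coefficient-quotient L (p ∘ suc) r j j<L

  module _ (*-cancelˡ-nonzero : ∀ {x y z} → ¬ x ≈ 0# → x * y ≈ x * z → y ≈ z) where

    -- The quotient by X − r₀ vanishes at the remaining points, hence is zero by induction,
    -- and the coefficients of p are recovered from it.
    vanishing⇒coefficients≈0 : ∀ L p (r : Fin L → Carrier) → (∀ {i j} → r i ≈ r j → i ≡ j) →
                               (∀ i → horner L p (r i) ≈ 0#) → ∀ k → k < L → p k ≈ 0#
    vanishing⇒coefficients≈0 (suc L) p r r-injective p[r]≈0 = coefficient
      where
      r₀ = r Fin.zero
      Q = quotient L p r₀

      Q[r]≈0 : ∀ i → horner L Q (r (Fin.suc i)) ≈ 0#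
      Q[r]≈0 i = *-cancelˡ-nonzero s−r₀≉0 (begin
        (s - r₀) * horner L Q s             ≈⟨ sym (+-identityˡ _) ⟩
        0# + (s - r₀) * horner L Q s        ≈⟨ +-congʳ (sym (p[r]≈0 Fin.zero)) ⟩
        horner (suc L) p r₀ + (s - r₀) * horner L Q s ≈⟨ sym (horner-quotient L p r₀ s) ⟩
        horner (suc L) p s                  ≈⟨ p[r]≈0 (Fin.suc i) ⟩
        0#                                  ≈⟨ sym (zeroʳ _) ⟩
        (s - r₀) * 0#                       ∎)
        where
        s = r (Fin.suc i)
        s−r₀≉0 : ¬ s - r₀ ≈ 0#
        s−r₀≉0 s−r₀≈0 with r-injective (x∙y⁻¹≈ε⇒x≈y s r₀ s−r₀≈0)
        ... | ()

      Q≈0 : ∀ k → Q k ≈ 0#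
      Q≈0 k with k ℕ.<? L
      ... | yes k<L = vanishing⇒coefficients≈0 L Q (r ∘ Fin.suc) (Fin.suc-injective ∘ r-injective) Q[r]≈0 k k<L
      ... | no  k≮L = reflexive (quotient-beyond L p r₀ k (ℕ.≮⇒≥ k≮L))

      coefficient : ∀ k → k < suc L → p k ≈ 0#
      coefficient zero    _         = begin
        p 0                                 ≈⟨ sym (+-identityʳ _) ⟩
        p 0 + 0#
          ≈⟨ +-congˡ (sym (trans (*-congˡ (trans (sym (quotient-zero L p r₀)) (Q≈0 0))) (zeroʳ r₀))) ⟩
        p 0 + r₀ * horner L (p ∘ suc) r₀    ≈⟨ p[r]≈0 Fin.zero ⟩
        0#                                  ∎
      coefficient (suc j) (s≤s j<L) = begin
        p (suc j)                           ≈⟨ coefficient-quotient L p r₀ j j<L ⟩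
        Q j - r₀ * Q (suc j)                ≈⟨ +-cong (Q≈0 j) (-‿cong (trans (*-congˡ (Q≈0 (suc j))) (zeroʳ r₀))) ⟩
        0# - 0#                             ≈⟨ -‿inverseʳ 0# ⟩
        0#                                  ∎

  monomial : Carrier → ℕ → ℕ → Carrier
  monomial c e k = if k ≡ᵇ e then c else 0#

  monomial-self : ∀ c e → monomial c e e ≡ c
  monomial-self c zero    = ≡.refl
  monomial-self c (suc e) = monomial-self c e

  monomial-≢ : ∀ c {e k} → e ≢ k → monomial c e k ≡ 0#
  monomial-≢ c {zero}  {zero}  e≢k = contradiction ≡.refl e≢k
  monomial-≢ c {zero}  {suc k} e≢k = ≡.refl
  monomial-≢ c {suc e} {zero}  e≢k = ≡.refl
  monomial-≢ c {suc e} {suc k} e≢k = monomial-≢ c (e≢k ∘ ≡.cong suc)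

  horner-monomial : ∀ L c e x → e < L → horner L (monomial c e) x ≈ c * x ^ e
  horner-monomial (suc L) c zero    x _ = begin
    c + x * horner L (λ _ → 0#) x   ≈⟨ +-congˡ (trans (*-congˡ (horner-zero L (λ _ → refl) x)) (zeroʳ x)) ⟩
    c + 0#                          ≈⟨ +-identityʳ c ⟩
    c                               ≈⟨ sym (*-identityʳ c) ⟩
    c * 1#                          ∎
  horner-monomial (suc L) c (suc e) x (s≤s e<L) = begin
    0# + x * horner L (monomial c e) x  ≈⟨ +-identityˡ _ ⟩
    x * horner L (monomial c e) x       ≈⟨ *-congˡ (horner-monomial L c e x e<L) ⟩
    x * (c * x ^ e)                     ≈⟨ x∙yz≈y∙xz x c _ ⟩
    c * (x * x ^ e)                     ∎

  Term : Set c
  Term = Carrier × ℕ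

  eval : List Term → Carrier → Carrier
  eval []             x = 0#
  eval ((c , e) ∷ ts) x = c * x ^ e + eval ts x

  exponents : List Term → List ℕ
  exponents = map proj₂

  coeff : List Term → ℕ → Carrier
  coeff []             k = 0#
  coeff ((c , e) ∷ ts) k = monomial c e k + coeff ts k

  horner-coeff : ∀ L ts x → All (_< L) (exponents ts) → horner L (coeff ts) x ≈ eval ts x
  horner-coeff L []             x []           = horner-zero L (λ _ → refl) x
  horner-coeff L ((c , e) ∷ ts) x (e<L ∷ ts<L) = begin
    horner L (λ k → monomial c e k + coeff ts k) x        ≈⟨ horner-+ L (monomial c e) (coeff ts) x ⟩
    horner L (monomial c e) x + horner L (coeff ts) x     ≈⟨ +-cong (horner-monomial L c e x e<L) (horner-coeff L ts x ts<L) ⟩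
    c * x ^ e + eval ts x                                 ∎

  coeff-∉ : ∀ ts {k} → k ∉ exponents ts → coeff ts k ≈ 0#
  coeff-∉ []             k∉ts = refl
  coeff-∉ ((c , e) ∷ ts) {k} k∉ts = begin
    monomial c e k + coeff ts k  ≈⟨ +-cong (reflexive (monomial-≢ c (k∉ts ∘ here ∘ ≡.sym))) (coeff-∉ ts (k∉ts ∘ there)) ⟩
    0# + 0#                      ≈⟨ +-identityʳ 0# ⟩
    0#                           ∎

  coeff-∈ : ∀ ts {c e} → Unique (exponents ts) → (c , e) ∈ ts → coeff ts e ≈ c
  coeff-∈ ((c , e) ∷ ts) (e∉ts ∷ _) (here ≡.refl) = begin
    monomial c e e + coeff ts e  ≈⟨ +-cong (reflexive (monomial-self c e)) (coeff-∉ ts (All¬⇒¬Any e∉ts)) ⟩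
    c + 0#                       ≈⟨ +-identityʳ c ⟩
    c                            ∎
  coeff-∈ ((c′ , e′) ∷ ts) {c} {e} (e′∉ts ∷ ts-unique) (there ce∈ts) = begin
    monomial c′ e′ e + coeff ts e
      ≈⟨ +-cong (reflexive (monomial-≢ c′ (All.lookup e′∉ts (∈-map⁺ proj₂ ce∈ts)))) (coeff-∈ ts ts-unique ce∈ts) ⟩
    0# + c                         ≈⟨ +-identityˡ c ⟩
    c                              ∎

  trinomial-expand : ∀ y s r₁ r₂ → y ^ s * ((y ^ r₁ + y ^ r₂) + 1#) ≈ (y ^ (s ℕ.+ r₁) + y ^ (s ℕ.+ r₂)) + y ^ s
  trinomial-expand y s r₁ r₂ = begin
    y ^ s * ((y ^ r₁ + y ^ r₂) + 1#)              ≈⟨ distribˡ _ _ _ ⟩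
    y ^ s * (y ^ r₁ + y ^ r₂) + y ^ s * 1#        ≈⟨ +-cong (distribˡ _ _ _) (*-identityʳ _) ⟩
    (y ^ s * y ^ r₁ + y ^ s * y ^ r₂) + y ^ s     ≈⟨ +-congʳ (+-cong (sym (^-homo-* y s r₁)) (sym (^-homo-* y s r₂))) ⟩
    (y ^ (s ℕ.+ r₁) + y ^ (s ℕ.+ r₂)) + y ^ s     ∎

  *-distribˡ-+₃ : ∀ x a b d → x * ((a + b) + d) ≈ (x * a + x * b) + x * d
  *-distribˡ-+₃ x a b d = trans (distribˡ x _ _) (+-congʳ (distribˡ x a b))

  eval-three : ∀ a b d x e f g → eval ((a , e) ∷ (b , f) ∷ (d , g) ∷ []) x ≈ (a * x ^ e + b * x ^ f) + d * x ^ g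
  eval-three a b d x e f g = trans (+-congˡ (+-congˡ (+-identityʳ _))) (sym (+-assoc _ _ _))

-- Finite fields

module FiniteField {c ℓ} (R : CommutativeRing c ℓ) (n : ℕ) .{{_ : NonZero n}} (F : IsFiniteFieldOfOrder R (suc n)) where
  open CommutativeRing R
  open IsFiniteFieldOfOrder F
  open Polynomials R
  open import Algebra.Properties.Ring ring using (x∙y⁻¹≈ε⇒x≈y; x≈y⇒x∙y⁻¹≈ε)
  open import Algebra.Properties.Semiring.Exp semiring using (_^_; ^-homo-*; ^-assocʳ; ^-congˡ)
  open import Algebra.Properties.CommutativeMonoid.Sum *-commutativeMonoid using (sum-permute; ∑-distrib-+) renaming (sum to product)
  open import Algebra.Properties.Monoid.Sum *-monoid using (sum-cong-≋; sum-replicate)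
  open import Relation.Binary.Reasoning.Setoid setoid
  private module card = Inverse card

  element : Fin (suc n) → Carrier
  element = card.to

  index : Carrier → Fin (suc n)
  index = card.from

  element-injective : ∀ {i j} → element i ≈ element j → i ≡ j
  element-injective {i} {j} eq = ≡.trans (≡.sym (card.strictlyInverseʳ i)) (≡.trans (card.from-cong eq) (card.strictlyInverseʳ j))

  _≟_ : Decidable _≈_
  x ≟ y with index x Fin.≟ index y
  ... | yes eq = yes (trans (sym (card.strictlyInverseˡ x)) (trans (reflexive (≡.cong element eq)) (card.strictlyInverseˡ y)))
  ... | no  ne = no (ne ∘ card.from-cong)

  *-cancelˡ-nonzero : ∀ {x y z} → ¬ x ≈ 0# → x * y ≈ x * z → y ≈ z
  *-cancelˡ-nonzero {x} {y} {z} x≉0 xy≈xz = begin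
    y              ≈⟨ sym (*-identityˡ y) ⟩
    1# * y         ≈⟨ *-congʳ (sym x⁻¹x≈1) ⟩
    (x⁻¹ * x) * y  ≈⟨ *-assoc _ _ _ ⟩
    x⁻¹ * (x * y)  ≈⟨ *-congˡ xy≈xz ⟩
    x⁻¹ * (x * z)  ≈⟨ sym (*-assoc _ _ _) ⟩
    (x⁻¹ * x) * z  ≈⟨ *-congʳ x⁻¹x≈1 ⟩
    1# * z         ≈⟨ *-identityˡ z ⟩
    z              ∎
    where
    x⁻¹ = proj₁ (inverse x x≉0)
    x⁻¹x≈1 = trans (*-comm x⁻¹ x) (proj₂ (inverse x x≉0))

  *-nonzero : ∀ {x y} → ¬ x ≈ 0# → ¬ y ≈ 0# → ¬ x * y ≈ 0#
  *-nonzero {x} x≉0 y≉0 xy≈0 = y≉0 (*-cancelˡ-nonzero x≉0 (trans xy≈0 (sym (zeroʳ x))))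

  private
    index₀ : Fin (suc n)
    index₀ = index 0#

    index₀≢index : ∀ {y} → ¬ y ≈ 0# → index₀ ≢ index y
    index₀≢index {y} y≉0 eq = y≉0 (begin
      y                ≈⟨ sym (card.strictlyInverseˡ y) ⟩
      element (index y) ≡⟨ ≡.cong element (≡.sym eq) ⟩
      element index₀   ≈⟨ card.strictlyInverseˡ 0# ⟩
      0#               ∎)

  unit : Fin n → Carrier
  unit i = element (punchIn index₀ i)

  unit≉0 : ∀ i → ¬ unit i ≈ 0#
  unit≉0 i ui≈0 = Fin.punchInᵢ≢i index₀ i (≡.trans (≡.sym (card.strictlyInverseʳ _)) (card.from-cong ui≈0))

  unitIndex : ∀ y → ¬ y ≈ 0# → Fin n
  unitIndex y y≉0 = punchOut (index₀≢index y≉0)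

  unit-unitIndex : ∀ y y≉0 → unit (unitIndex y y≉0) ≈ y
  unit-unitIndex y y≉0 = begin
    element (punchIn index₀ (punchOut (index₀≢index y≉0))) ≡⟨ ≡.cong element (Fin.punchIn-punchOut _) ⟩
    element (index y)                                      ≈⟨ card.strictlyInverseˡ y ⟩
    y                                                      ∎

  unitIndex-unit : ∀ i ui≉0 → unitIndex (unit i) ui≉0 ≡ i
  unitIndex-unit i ui≉0 = ≡.trans (Fin.punchOut-cong index₀ (card.strictlyInverseʳ _)) (Fin.punchOut-punchIn index₀)

  unitIndex-cong : ∀ {x y} x≉0 y≉0 → x ≈ y → unitIndex x x≉0 ≡ unitIndex y y≉0
  unitIndex-cong _ _ x≈y = Fin.punchOut-cong index₀ (card.from-cong x≈y)

  product-nonzero : ∀ m (f : Fin m → Carrier) → (∀ i → ¬ f i ≈ 0#) → ¬ product f ≈ 0#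
  product-nonzero zero    f f≉0 1≈0 = 0≉1 (sym 1≈0)
  product-nonzero (suc m) f f≉0     = *-nonzero (f≉0 Fin.zero) (product-nonzero m (f ∘ Fin.suc) (f≉0 ∘ Fin.suc))

  unit-scale : ∀ y → ¬ y ≈ 0# → Fin n → Fin n
  unit-scale y y≉0 i = unitIndex (y * unit i) (*-nonzero y≉0 (unit≉0 i))

  unit-scale-cancel : ∀ {y z} y≉0 z≉0 → y * z ≈ 1# → ∀ i → unit-scale y y≉0 (unit-scale z z≉0 i) ≡ i
  unit-scale-cancel {y} {z} y≉0 z≉0 yz≈1 i = ≡.trans (unitIndex-cong (*-nonzero y≉0 (unit≉0 _)) (unit≉0 i) (begin
    y * unit (unit-scale z z≉0 i) ≈⟨ *-congˡ (unit-unitIndex _ (*-nonzero z≉0 (unit≉0 i))) ⟩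
    y * (z * unit i)              ≈⟨ sym (*-assoc y z _) ⟩
    (y * z) * unit i              ≈⟨ *-congʳ yz≈1 ⟩
    1# * unit i                   ≈⟨ *-identityˡ _ ⟩
    unit i                        ∎)) (unitIndex-unit i (unit≉0 i))

  unit-scaling : ∀ {x} → ¬ x ≈ 0# → Permutation n n
  unit-scaling {x} x≉0 = Perm.permutation (unit-scale x x≉0) (unit-scale x⁻¹ x⁻¹≉0)
    (unit-scale-cancel x≉0 x⁻¹≉0 xx⁻¹≈1) (unit-scale-cancel x⁻¹≉0 x≉0 (trans (*-comm x⁻¹ x) xx⁻¹≈1))
    where
    x⁻¹ = proj₁ (inverse x x≉0)
    xx⁻¹≈1 = proj₂ (inverse x x≉0)
    x⁻¹≉0 : ¬ x⁻¹ ≈ 0#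
    x⁻¹≉0 x⁻¹≈0 = 0≉1 (trans (sym (zeroʳ x)) (trans (*-congˡ (sym x⁻¹≈0)) xx⁻¹≈1))

  x^n≈1 : ∀ {x} → ¬ x ≈ 0# → x ^ n ≈ 1#
  x^n≈1 {x} x≉0 = *-cancelˡ-nonzero (product-nonzero n unit unit≉0) (begin
    product unit * x ^ n                          ≈⟨ *-comm _ _ ⟩
    x ^ n * product unit                          ≈⟨ *-congʳ (sym (sum-replicate n)) ⟩
    product {n} (λ _ → x) * product unit         ≈⟨ sym (∑-distrib-+ (λ _ → x) unit) ⟩
    product (λ i → x * unit i)                    ≈⟨ sum-cong-≋ (λ i → sym (unit-unitIndex (x * unit i) (*-nonzero x≉0 (unit≉0 i)))) ⟩
    product (unit ∘ unit-scale x x≉0)             ≈⟨ sym (sum-permute unit (unit-scaling x≉0)) ⟩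
    product unit                                  ≈⟨ sym (*-identityʳ _) ⟩
    product unit * 1#                             ∎)

  x^k≈x^[k%n] : ∀ {x} → ¬ x ≈ 0# → ∀ k → x ^ k ≈ x ^ (k % n)
  x^k≈x^[k%n] {x} x≉0 k = begin
    x ^ k                               ≡⟨ ≡.cong (x ^_) (m≡m%n+[m/n]*n k n) ⟩
    x ^ (k % n ℕ.+ k / n ℕ.* n)         ≈⟨ ^-homo-* x (k % n) _ ⟩
    x ^ (k % n) * x ^ (k / n ℕ.* n)     ≡⟨ ≡.cong (λ e → x ^ (k % n) * x ^ e) (ℕ.*-comm (k / n) n) ⟩
    x ^ (k % n) * x ^ (n ℕ.* (k / n))   ≈⟨ *-congˡ (sym (^-assocʳ x n (k / n))) ⟩
    x ^ (k % n) * (x ^ n) ^ (k / n)     ≈⟨ *-congˡ (^-congˡ (k / n) (x^n≈1 x≉0)) ⟩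
    x ^ (k % n) * 1# ^ (k / n)          ≈⟨ *-congˡ (1^k≈1 (k / n)) ⟩
    x ^ (k % n) * 1#                    ≈⟨ *-identityʳ _ ⟩
    x ^ (k % n)                         ∎
    where
    1^k≈1 : ∀ k → 1# ^ k ≈ 1#
    1^k≈1 zero    = refl
    1^k≈1 (suc k) = trans (*-identityˡ _) (1^k≈1 k)

  x*x^k≈x*x^[k%n] : ∀ x k → x * x ^ k ≈ x * x ^ (k % n)
  x*x^k≈x*x^[k%n] x k with x ≟ 0#
  ... | yes x≈0 = trans (*-congʳ x≈0) (trans (zeroˡ _) (sym (trans (*-congʳ x≈0) (zeroˡ _))))
  ... | no  x≉0 = *-congˡ (x^k≈x^[k%n] x≉0 k)

  eval≈⇒coeff≈ : ∀ P T → All (_< suc n) (exponents P) → All (_< suc n) (exponents T) →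
                 (∀ x → eval P x ≈ eval T x) → ∀ k → k < suc n → coeff P k ≈ coeff T k
  eval≈⇒coeff≈ P T P<n T<n P≈T k k<n = x∙y⁻¹≈ε⇒x≈y _ _
    (vanishing⇒coefficients≈0 *-cancelˡ-nonzero (suc n) (λ k → coeff P k - coeff T k) element element-injective
      difference-vanishes k k<n)
    where
    difference-vanishes : ∀ i → horner (suc n) (λ k → coeff P k - coeff T k) (element i) ≈ 0#
    difference-vanishes i = begin
      horner (suc n) (λ k → coeff P k - coeff T k) x      ≈⟨ horner-- (suc n) (coeff P) (coeff T) x ⟩
      horner (suc n) (coeff P) x - horner (suc n) (coeff T) x
        ≈⟨ +-cong (horner-coeff (suc n) P x P<n) (-‿cong (horner-coeff (suc n) T x T<n)) ⟩
      eval P x - eval T x                                 ≈⟨ x≈y⇒x∙y⁻¹≈ε (P≈T x) ⟩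
      0#                                                  ∎
      where x = element i

  exponent-matched : ∀ P T {a e} → All (_< suc n) (exponents P) → All (_< suc n) (exponents T) →
                     Unique (exponents P) → (∀ x → eval P x ≈ eval T x) →
                     (a , e) ∈ P → ¬ a ≈ 0# → e ∈ exponents T
  exponent-matched P T {a} {e} P<n T<n P-unique P≈T ae∈P a≉0 with e ∈? exponents T
  ... | yes e∈T = e∈T
  ... | no  e∉T = contradiction (begin
    a          ≈⟨ sym (coeff-∈ P P-unique ae∈P) ⟩
    coeff P e  ≈⟨ eval≈⇒coeff≈ P T P<n T<n P≈T e (All.lookup P<n (∈-map⁺ proj₂ ae∈P)) ⟩
    coeff T e  ≈⟨ coeff-∉ T e∉T ⟩
    0#         ∎) a≉0

-- The exponents of F₁ and F₂

F₁-exponent : ℕ → ℕ → ℕ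
F₁-exponent q p = 11 ℕ.+ p ℕ.* (q ∸ 1)

F₂-exponent : ℕ → ℕ → ℕ
F₂-exponent q o = 9 ℕ.+ o ℕ.* (q ∸ 1)

F₁-powers F₂-powers : List ℕ
F₁-powers = 10 ∷ 4 ∷ 0 ∷ []
F₂-powers = 8 ∷ 6 ∷ 0 ∷ []

Matched : (q n d : ℕ) .{{_ : NonZero n}} → ℕ → Set
Matched q n d p = Any (λ o → d ℕ.* F₂-exponent q o % n ≡ F₁-exponent q p % n) F₂-powers

matched? : ∀ q n d .{{_ : NonZero n}} p → Dec (Matched q n d p)
matched? q n d p = any? (λ o → d ℕ.* F₂-exponent q o % n ℕ.≟ F₁-exponent q p % n) F₂-powers

module QMEquivalence {c ℓ} (R : CommutativeRing c ℓ) (n : ℕ) .{{_ : NonZero n}} (F : IsFiniteFieldOfOrder R (suc n)) where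
  open CommutativeRing R
  open IsFiniteFieldOfOrder F
  open Polynomials R
  open FiniteField R n F
  open import Algebra.Properties.Semiring.Exp semiring using (_^_; ^-assocʳ)
  open import Algebra.Properties.CommutativeSemiring.Exp commutativeSemiring using (^-distrib-*)
  open import Algebra.Solver.Ring.NaturalCoefficients.Default commutativeSemiring using (solve; _:*_; _:=_)
  open import Relation.Binary.Reasoning.Setoid setoid

  exponents-bounded : ∀ (f : ℕ → ℕ) xs → All (_< suc n) (map (λ x → suc (f x % n)) xs)
  exponents-bounded f []       = []
  exponents-bounded f (x ∷ xs) = s≤s (m%n<n (f x) n) ∷ exponents-bounded f xs

  module _ (q d : ℕ) (α β : Carrier) where

    F₁-term F₂-term : ℕ → Term
    F₁-term p = 1# , suc (F₁-exponent q p % n)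
    F₂-term o = α * β ^ F₂-exponent q o , suc (d ℕ.* F₂-exponent q o % n)

    F₁-terms F₂-terms : List Term
    F₁-terms = map F₁-term F₁-powers
    F₂-terms = map F₂-term F₂-powers

    x*F₁≈ : ∀ x → x * F₁ R q x ≈ eval F₁-terms x
    x*F₁≈ x = begin
      x * F₁ R q x                                         ≈⟨ *-congˡ (trinomial-expand x 11 (10 ℕ.* (q ∸ 1)) (4 ℕ.* (q ∸ 1))) ⟩
      x * ((x ^ A 10 + x ^ A 4) + x ^ A 0)                 ≈⟨ *-distribˡ-+₃ x _ _ _ ⟩
      (x * x ^ A 10 + x * x ^ A 4) + x * x ^ A 0           ≈⟨ +-cong (+-cong (reduce 10) (reduce 4)) (reduce 0) ⟩
      (1# * x ^ a 10 + 1# * x ^ a 4) + 1# * x ^ a 0        ≈⟨ sym (eval-three 1# 1# 1# x (a 10) (a 4) (a 0)) ⟩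
      eval F₁-terms x                                      ∎
      where
      A = F₁-exponent q
      a : ℕ → ℕ
      a p = suc (A p % n)
      reduce : ∀ p → x * x ^ A p ≈ 1# * x ^ a p
      reduce p = trans (x*x^k≈x*x^[k%n] x (A p)) (sym (*-identityˡ _))

    x*αF₂≈ : ∀ x → x * (α * F₂ R q (β * x ^ d)) ≈ eval F₂-terms x
    x*αF₂≈ x = begin
      x * (α * F₂ R q y)                                        ≈⟨ *-congˡ (*-congˡ (trinomial-expand y 9 (8 ℕ.* (q ∸ 1)) (6 ℕ.* (q ∸ 1)))) ⟩
      x * (α * ((y ^ E 8 + y ^ E 6) + y ^ E 0))                 ≈⟨ *-congˡ (*-distribˡ-+₃ α _ _ _) ⟩
      x * ((α * y ^ E 8 + α * y ^ E 6) + α * y ^ E 0)           ≈⟨ *-distribˡ-+₃ x _ _ _ ⟩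
      (x * (α * y ^ E 8) + x * (α * y ^ E 6)) + x * (α * y ^ E 0) ≈⟨ +-cong (+-cong (term 8) (term 6)) (term 0) ⟩
      (γ 8 * x ^ e 8 + γ 6 * x ^ e 6) + γ 0 * x ^ e 0            ≈⟨ sym (eval-three (γ 8) (γ 6) (γ 0) x (e 8) (e 6) (e 0)) ⟩
      eval F₂-terms x                                           ∎
      where
      y = β * x ^ d
      E = F₂-exponent q
      γ : ℕ → Carrier
      γ o = α * β ^ E o
      e : ℕ → ℕ
      e o = suc (d ℕ.* E o % n)
      shuffle : ∀ x α b z → x * (α * (b * z)) ≈ (α * b) * (x * z)
      shuffle = solve 4 (λ x α b z → (x :* (α :* (b :* z))) := ((α :* b) :* (x :* z))) refl
      term : ∀ o → x * (α * y ^ E o) ≈ γ o * x ^ e o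
      term o = begin
        x * (α * y ^ E o)                          ≈⟨ *-congˡ (*-congˡ (trans (^-distrib-* β (x ^ d) (E o)) (*-congˡ (^-assocʳ x d (E o))))) ⟩
        x * (α * (β ^ E o * x ^ (d ℕ.* E o)))      ≈⟨ shuffle x α _ _ ⟩
        (α * β ^ E o) * (x * x ^ (d ℕ.* E o))      ≈⟨ *-congˡ (x*x^k≈x*x^[k%n] x (d ℕ.* E o)) ⟩
        (α * β ^ E o) * x ^ suc (d ℕ.* E o % n)    ∎

    QM⇒F₁-matched : Unique (map (λ p → F₁-exponent q p % n) F₁-powers) →
                    (∀ x → F₁ R q x ≈ α * F₂ R q (β * x ^ d)) → All (Matched q n d) F₁-powers
    QM⇒F₁-matched F₁-distinct F₁≈αF₂ = All.tabulate λ {p} p∈F₁ →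
      exponent∈⇒matched {p} (exponent-matched F₁-terms F₂-terms
        (exponents-bounded (F₁-exponent q) F₁-powers) (exponents-bounded (λ o → d ℕ.* F₂-exponent q o) F₂-powers)
        (Unique.map⁺ ℕ.suc-injective F₁-distinct) F₁≈F₂ (∈-map⁺ F₁-term p∈F₁) (0≉1 ∘ sym))
      where
      F₁≈F₂ : ∀ x → eval F₁-terms x ≈ eval F₂-terms x
      F₁≈F₂ x = trans (sym (x*F₁≈ x)) (trans (*-congˡ (F₁≈αF₂ x)) (x*αF₂≈ x))
      exponent∈⇒matched : ∀ {p} → proj₂ (F₁-term p) ∈ exponents F₂-terms → Matched q n d p
      exponent∈⇒matched = Any.map (ℕ.suc-injective ∘ ≡.sym) ∘ map⁻ {f = proj₂ ∘ F₂-term} {xs = F₂-powers}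

-- Arithmetic modulo q + 1

module Congruences where
  open import Data.Integer as ℤ using (ℤ; +_; _+_; _-_; _*_; -_; 0ℤ; 1ℤ; ∣_∣)
  import Data.Integer.Properties as ℤ
  open import Data.Integer.Divisibility.Signed
    using (_∣_; divides; ∣m+n∣n⇒∣m; ∣m⇒∣m*n; ∣n⇒∣m*n; ∣m∣n⇒∣m+n; ∣m⇒∣-m; ∣-trans; ∣-refl; ∣⇒∣ᵤ)
  open import Data.Integer.Tactic.RingSolver using (solve-∀)
  open import Data.Nat.Divisibility using (∣⇒≤)
  open ≡ using (refl; sym; trans; cong; cong₂; subst)
  open ≡.≡-Reasoning

  x%n≡y%n⇒n∣x-y : ∀ {n} .{{_ : NonZero n}} x y → x % n ≡ y % n → + n ∣ + x - + y
  x%n≡y%n⇒n∣x-y {n} x y x≡y = divides (+ (x / n) - + (y / n)) (begin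
    + x - + y                                                      ≡⟨ cong₂ _-_ (split x) (split y) ⟩
    (+ (x % n) + + (x / n) * + n) - (+ (y % n) + + (y / n) * + n)
      ≡⟨ cong (λ r → (+ r + + (x / n) * + n) - (+ (y % n) + + (y / n) * + n)) x≡y ⟩
    (+ (y % n) + + (x / n) * + n) - (+ (y % n) + + (y / n) * + n)  ≡⟨ cancel (+ (y % n)) (+ (x / n)) (+ (y / n)) (+ n) ⟩
    (+ (x / n) - + (y / n)) * + n                                  ∎)
    where
    split : ∀ z → + z ≡ + (z % n) + + (z / n) * + n
    split z = trans (cong +_ (m≡m%n+[m/n]*n z n)) (trans (ℤ.pos-+ (z % n) _) (cong (λ t → + (z % n) + t) (ℤ.pos-* (z / n) n)))
    cancel : ∀ r a b n → (r + a * n) - (r + b * n) ≡ (a - b) * n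
    cancel = solve-∀

  reduced : ℕ → ℕ → ℤ
  reduced k o = + k - + 2 * + o

  ∣-linear-combination : ∀ {k x} c₁ c₂ c₃ {u₁ u₂ u₃ v₁ v₂ v₃} → c₁ * u₁ + c₂ * u₂ + c₃ * u₃ ≡ 0ℤ →
                         k ∣ u₁ * x - v₁ → k ∣ u₂ * x - v₂ → k ∣ u₃ * x - v₃ → k ∣ c₁ * v₁ + c₂ * v₂ + c₃ * v₃
  ∣-linear-combination {k} {x} c₁ c₂ c₃ {u₁} {u₂} {u₃} {v₁} {v₂} {v₃} cu≡0 k∣₁ k∣₂ k∣₃ =
    subst (k ∣_) combination≡
      (∣m⇒∣-m (∣m∣n⇒∣m+n (∣m∣n⇒∣m+n (∣n⇒∣m*n c₁ k∣₁) (∣n⇒∣m*n c₂ k∣₂)) (∣n⇒∣m*n c₃ k∣₃)))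
    where
    w = c₁ * v₁ + c₂ * v₂ + c₃ * v₃
    expand : ∀ c₁ c₂ c₃ u₁ u₂ u₃ v₁ v₂ v₃ x →
      - (c₁ * (u₁ * x - v₁) + c₂ * (u₂ * x - v₂) + c₃ * (u₃ * x - v₃)) ≡
      (c₁ * v₁ + c₂ * v₂ + c₃ * v₃) - (c₁ * u₁ + c₂ * u₂ + c₃ * u₃) * x
    expand = solve-∀
    combination≡ : - (c₁ * (u₁ * x - v₁) + c₂ * (u₂ * x - v₂) + c₃ * (u₃ * x - v₃)) ≡ w
    combination≡ = begin
      _                   ≡⟨ expand c₁ c₂ c₃ u₁ u₂ u₃ v₁ v₂ v₃ x ⟩
      w - (c₁ * u₁ + c₂ * u₂ + c₃ * u₃) * x ≡⟨ cong (λ t → w - t * x) cu≡0 ⟩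
      w - 0ℤ * x          ≡⟨ ℤ.+-identityʳ w ⟩
      w                   ∎

  +suc≡+1 : ∀ j → + suc j ≡ + j + 1ℤ
  +suc≡+1 j = cong +_ (ℕ.+-comm 1 j)

  +[q*q∸1]≡[q-1][q+1] : ∀ {q} → 1 ≤ q → + (q ℕ.* q ∸ 1) ≡ + (q ∸ 1) * (+ q + 1ℤ)
  +[q*q∸1]≡[q-1][q+1] {suc j} _ = begin
    + (j ℕ.+ j ℕ.* suc j)           ≡⟨ trans (ℤ.pos-+ j _) (cong (λ t → + j + t) (ℤ.pos-* j (suc j))) ⟩
    + j + + j * + suc j             ≡⟨ cong (λ t → + j + + j * t) (+suc≡+1 j) ⟩
    + j + + j * (+ j + 1ℤ)          ≡⟨ factor (+ j) ⟩
    + j * ((+ j + 1ℤ) + 1ℤ)         ≡⟨ cong (λ t → + j * (t + 1ℤ)) (sym (+suc≡+1 j)) ⟩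
    + j * (+ suc j + 1ℤ)            ∎
    where
    factor : ∀ j → j + j * (j + 1ℤ) ≡ j * ((j + 1ℤ) + 1ℤ)
    factor = solve-∀

  -- Since q ≡ -1 (mod q + 1), the exponent k + o (q - 1) is congruent to k - 2o.
  exponent≡reduced : ∀ {q} → 1 ≤ q → ∀ k o → + (k ℕ.+ o ℕ.* (q ∸ 1)) ≡ reduced k o + + o * (+ q + 1ℤ)
  exponent≡reduced {suc j} _ k o = begin
    + (k ℕ.+ o ℕ.* j)                     ≡⟨ trans (ℤ.pos-+ k _) (cong (λ t → + k + t) (ℤ.pos-* o j)) ⟩
    + k + + o * + j                       ≡⟨ shift (+ k) (+ o) (+ j) ⟩
    reduced k o + + o * ((+ j + 1ℤ) + 1ℤ) ≡⟨ cong (λ t → reduced k o + + o * (t + 1ℤ)) (sym (+suc≡+1 j)) ⟩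
    reduced k o + + o * (+ suc j + 1ℤ)    ∎
    where
    shift : ∀ k o j → k + o * j ≡ (k - + 2 * o) + o * ((j + 1ℤ) + 1ℤ)
    shift = solve-∀

  -- Coefficients eliminating d from the congruences reduced 9 oᵢ · d ≡ reduced 11 pᵢ (mod q + 1),
  -- (p₁, p₂, p₃) = (10, 4, 0), leaving a nonzero integer of absolute value at most 32.
  Elimination : ℕ → ℕ → ℕ → ℤ × ℤ × ℤ → Set
  Elimination o₁ o₂ o₃ (c₁ , c₂ , c₃) =
    c₁ * reduced 9 o₁ + c₂ * reduced 9 o₂ + c₃ * reduced 9 o₃ ≡ 0ℤ ×
    0 < ∣ c₁ * reduced 11 10 + c₂ * reduced 11 4 + c₃ * reduced 11 0 ∣ ×
    ∣ c₁ * reduced 11 10 + c₂ * reduced 11 4 + c₃ * reduced 11 0 ∣ ≤ 32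

  elimination? : ∀ o₁ o₂ o₃ c → Dec (Elimination o₁ o₂ o₃ c)
  elimination? o₁ o₂ o₃ (c₁ , c₂ , c₃) = (_ ℤ.≟ 0ℤ) ×-dec (0 ℕ.<? _) ×-dec (_ ℕ.≤? 32)

  small-coefficients : List (ℤ × ℤ × ℤ)
  small-coefficients = cartesianProduct range (cartesianProduct range range)
    where
    range : List ℤ
    range = map (λ k → + k - + 3) (upTo 7)

  -- Abstract, so that the search is not re-evaluated wherever eliminations meets unification.
  abstract
    eliminations : All (λ o₁ → All (λ o₂ → All (λ o₃ →
                     Any (Elimination o₁ o₂ o₃) small-coefficients) F₂-powers) F₂-powers) F₂-powers
    eliminations = from-yes (all? (λ o₁ → all? (λ o₂ → all? (λ o₃ →
                     any? (elimination? o₁ o₂ o₃) small-coefficients) F₂-powers) F₂-powers) F₂-powers)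

  module Residues (q : ℕ) (1≤q : 1 ≤ q) .{{_ : NonZero (q ℕ.* q ∸ 1)}} where

    M : ℤ
    M = + q + 1ℤ

    private
      n : ℕ
      n = q ℕ.* q ∸ 1

    M∣n : M ∣ + n
    M∣n = divides (+ (q ∸ 1)) (+[q*q∸1]≡[q-1][q+1] 1≤q)

    ≡[mod-n]⇒M∣- : ∀ {x y} → x % n ≡ y % n → M ∣ + x - + y
    ≡[mod-n]⇒M∣- ≡mod = ∣-trans M∣n (x%n≡y%n⇒n∣x-y _ _ ≡mod)

    M∣-drop-multiple : ∀ {r} t → M ∣ r + M * t → M ∣ r
    M∣-drop-multiple t M∣r+Mt = ∣m+n∣n⇒∣m M∣r+Mt (∣m⇒∣m*n t ∣-refl)

    matched⇒M∣ : ∀ d o p → d ℕ.* F₂-exponent q o % n ≡ F₁-exponent q p % n → M ∣ reduced 9 o * + d - reduced 11 p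
    matched⇒M∣ d o p ≡mod = M∣-drop-multiple (+ o * + d - + p) (subst (M ∣_) difference≡ (≡[mod-n]⇒M∣- ≡mod))
      where
      regroup : ∀ d r s o p M → d * (r + o * M) - (s + p * M) ≡ (r * d - s) + M * (o * d - p)
      regroup = solve-∀
      difference≡ : + (d ℕ.* F₂-exponent q o) - + F₁-exponent q p ≡ reduced 9 o * + d - reduced 11 p + M * (+ o * + d - + p)
      difference≡ = begin
        + (d ℕ.* F₂-exponent q o) - + F₁-exponent q p
          ≡⟨ cong₂ _-_ (trans (ℤ.pos-* d _) (cong (+ d *_) (exponent≡reduced 1≤q 9 o))) (exponent≡reduced 1≤q 11 p) ⟩
        + d * (reduced 9 o + + o * M) - (reduced 11 p + + p * M)
          ≡⟨ regroup (+ d) (reduced 9 o) (reduced 11 p) (+ o) (+ p) M ⟩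
        reduced 9 o * + d - reduced 11 p + M * (+ o * + d - + p) ∎

    F₁-collision⇒M∣ : ∀ p p′ → F₁-exponent q p % n ≡ F₁-exponent q p′ % n → M ∣ reduced 11 p - reduced 11 p′
    F₁-collision⇒M∣ p p′ ≡mod = M∣-drop-multiple (+ p - + p′) (subst (M ∣_) difference≡ (≡[mod-n]⇒M∣- ≡mod))
      where
      regroup : ∀ r s p p′ M → (r + p * M) - (s + p′ * M) ≡ (r - s) + M * (p - p′)
      regroup = solve-∀
      difference≡ : + F₁-exponent q p - + F₁-exponent q p′ ≡ reduced 11 p - reduced 11 p′ + M * (+ p - + p′)
      difference≡ = trans (cong₂ _-_ (exponent≡reduced 1≤q 11 p) (exponent≡reduced 1≤q 11 p′))
                          (regroup (reduced 11 p) (reduced 11 p′) (+ p) (+ p′) M)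

    M∤small : ∀ {z} → 0 < ∣ z ∣ → ∣ z ∣ ≤ q → ¬ M ∣ z
    M∤small {z} 0<∣z∣ ∣z∣≤q M∣z = ℕ.m+1+n≰m q (ℕ.≤-trans (∣⇒≤ {{ℕ.>-nonZero 0<∣z∣}} (∣⇒∣ᵤ M∣z)) ∣z∣≤q)

    module _ (32≤q : 32 ≤ q) where

      large-q-unmatched : ∀ d → ¬ All (Matched q n d) F₁-powers
      large-q-unmatched d (m₁₀ ∷ m₄ ∷ m₀ ∷ []) =
        let E₁ , h₁₀ = lookupAny eliminations (Any.map (λ {o} → matched⇒M∣ d o 10) m₁₀)
            E₂ , h₄  = lookupAny E₁ (Any.map (λ {o} → matched⇒M∣ d o 4) m₄)
            E₃ , h₀  = lookupAny E₂ (Any.map (λ {o} → matched⇒M∣ d o 0) m₀)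
            (c₁ , c₂ , c₃) , cu≡0 , 0<∣w∣ , ∣w∣≤32 = satisfied E₃
        in M∤small 0<∣w∣ (ℕ.≤-trans ∣w∣≤32 32≤q) (∣-linear-combination c₁ c₂ c₃ cu≡0 h₁₀ h₄ h₀)

      large-q-distinct : Unique (map (λ p → F₁-exponent q p % n) F₁-powers)
      large-q-distinct = (distinct 10 4 ∷ distinct 10 0 ∷ []) ∷ (distinct 4 0 ∷ []) ∷ [] ∷ []
        where
        distinct : ∀ p p′ {pos : True (0 ℕ.<? ∣ reduced 11 p - reduced 11 p′ ∣)}
                   {≤32 : True (∣ reduced 11 p - reduced 11 p′ ∣ ℕ.≤? 32)} →
                   F₁-exponent q p % n ≢ F₁-exponent q p′ % n
        distinct p p′ {pos} {≤32} ≡mod =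
          M∤small (toWitness pos) (ℕ.≤-trans (toWitness ≤32) 32≤q) (F₁-collision⇒M∣ p p′ ≡mod)

-- Powers of two

q=8-distinct : Unique (map (λ p → F₁-exponent 8 p % 63) F₁-powers)
q=8-distinct = ((λ ()) ∷ (λ ()) ∷ []) ∷ ((λ ()) ∷ []) ∷ [] ∷ []

q=8-unmatched : ∀ d → d < 63 → ¬ All (Matched 8 63 d) F₁-powers
q=8-unmatched d d<63 = ≡.subst (λ d → ¬ All (Matched 8 63 d) F₁-powers) (Fin.toℕ-fromℕ< d<63) (unmatched (fromℕ< d<63))
  where
  unmatched : ∀ (i : Fin 63) → ¬ All (Matched 8 63 (toℕ i)) F₁-powers
  unmatched = from-yes (Fin.all? {n = 63} λ i → ¬? (all? (matched? 8 63 (toℕ i)) F₁-powers))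

odd>1⇒3⊎≥5 : ∀ {m} → 1 < m → m % 2 ≡ 1 → m ≡ 3 ⊎ 5 ≤ m
odd>1⇒3⊎≥5 {3}                           _ _ = inj₁ ≡.refl
odd>1⇒3⊎≥5 {suc (suc (suc (suc (suc m))))} _ _ = inj₂ (s≤s (s≤s (s≤s (s≤s (s≤s z≤n)))))
odd>1⇒3⊎≥5 {2} _ ()
odd>1⇒3⊎≥5 {4} _ ()
odd>1⇒3⊎≥5 {1} (s≤s ())

module PowerOfTwo (m : ℕ) (1<m : 1 < m) (m-odd : m % 2 ≡ 1) .{{_ : NonZero (2 ℕ.^ m ℕ.* 2 ℕ.^ m ∸ 1)}} where

  private
    q n : ℕ
    q = 2 ℕ.^ m
    n = q ℕ.* q ∸ 1
    1≤q : 1 ≤ q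
    1≤q = ℕ.m^n>0 2 m
    32≤q : 5 ≤ m → 32 ≤ q
    32≤q = ℕ.^-monoʳ-≤ 2

  F₁-exponents-distinct : Unique (map (λ p → F₁-exponent q p % n) F₁-powers)
  F₁-exponents-distinct with odd>1⇒3⊎≥5 1<m m-odd
  ... | inj₁ ≡.refl = q=8-distinct
  ... | inj₂ 5≤m  = Congruences.Residues.large-q-distinct q 1≤q (32≤q 5≤m)

  F₁-unmatched : ∀ d → d < n → ¬ All (Matched q n d) F₁-powers
  F₁-unmatched d d<n with odd>1⇒3⊎≥5 1<m m-odd
  ... | inj₁ ≡.refl = q=8-unmatched d d<n
  ... | inj₂ 5≤m  = Congruences.Residues.large-q-unmatched q 1≤q (32≤q 5≤m) d

open import Level using (Level)
open import Data.Nat using (_*_; _^_)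
open import Data.Nat.Divisibility using (_∣_)

proposition4p4 : ∀ {c ℓ : Level} (m : ℕ) → 1 < m → m % 2 ≡ 1 → ¬ (5 ∣ m) →
    (R : CommutativeRing c ℓ) → IsFiniteFieldOfOrder R ((2 ^ m) * (2 ^ m)) →
    ¬ QMEquivalent R ((2 ^ m) * (2 ^ m)) (F₁ R (2 ^ m)) (F₂ R (2 ^ m))
proposition4p4 m 1<m m-odd _ R F (d , α , β , _ , d<n , _ , _ , _ , F₁≈αF₂) =
  F₁-unmatched d d<n (QM⇒F₁-matched q d α β F₁-exponents-distinct F₁≈αF₂)
  where
  q = 2 ^ m
  1<q*q : 1 < q * q
  1<q*q = ℕ.<-≤-trans (s≤s (s≤s z≤n)) (ℕ.*-mono-≤ 2≤q 2≤q)
    where 2≤q = ℕ.^-monoʳ-≤ 2 (ℕ.<⇒≤ 1<m)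
  instance
    n≢0 : NonZero (q * q ∸ 1)
    n≢0 = ℕ.>-nonZero (ℕ.m<n⇒0<n∸m 1<q*q)
  open PowerOfTwo m 1<m m-odd
  open QMEquivalence R (q * q ∸ 1) (≡.subst (IsFiniteFieldOfOrder R) (≡.sym (ℕ.m+[n∸m]≡n (ℕ.<⇒≤ 1<q*q))) F)
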